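{- Let $M$ be a partial multiplication matrix with given row and column signs and nonzero cells $C_1,\dots,C_n$. There is a monadic second-order sentence $\mathrm{Min}_M$ in the language $\{<_1,<_2,C_1,\dots,C_n\}$, computable from $M$, such that for every $M$-gridded permutation $\pi^\sharp\in\mathrm{Geom}^\sharp(M)$, $\pi^\sharp\models\mathrm{Min}_M$ if and only if $\pi^\sharp$ is $<_{lex}$-minimal among all $M$-griddings of its underlying permutation.
   Context: A permutation is a finite set with two linear orders $<_1,<_2$. A finite point set in the plane with distinct coordinates determines a permutation ($<_1$ left-to-right, $<_2$ bottom-to-top). For a finite matrix $M$ with entries in $\{0,1,-1\}$, in the grid of unit cells draw in each cell with entry $1$ the open segment from bottom-left to top-right, in each cell with entry $-1$ the open segment from top-left to bottom-right, nothing for entry $0$ (the standard figure); $\mathrm{Geom}(M)$ is the set of finite permutations determined by finite point sets on it. $M$ is a partial multiplication matrix if each row and column is assigned a sign in $\{1,-1\}$ so that each nonzero entry equals the product of its row and column signs. $\mathrm{Geom}^\sharp(M)$ consists of structures $(\pi,<_1,<_2,C_1,\dots,C_n)$, the unary relations $C_i$ (one for each nonzero cell) partitioning the domain, such that $\pi$ can be drawn on the standard figure with the points of $C_i$ in cell $C_i$; such a structure is an $M$-gridding of the permutation $\pi$. Define a linear order $\prec_{lex}$ on the nonzero cells: $C_i\prec_{lex}C_j$ if $C_i$ is in a lower row than $C_j$, or they are in the same row and $C_i$ is left of $C_j$. For two $M$-griddings $\sigma^\sharp,\tau^\sharp$ of the same permutation on the same domain, set $\sigma^\sharp<_{lex}\tau^\sharp$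 if, letting $p$ be the $<_1$-least point placed in different cells by the two griddings, $p\in C_i$ in $\sigma^\sharp$ and $p\in C_j$ in $\tau^\sharp$ with $C_i\prec_{lex}C_j$. Monadic second-order logic: formulas with element and set variables, atomic formulas from the language, equality and membership, Boolean connectives, and quantification over elements and subsets.
   Formalization: Points drawn on the standard figure have rational coordinates, both for $\pi^\sharp$ and for the competing $M$-griddings against which $<_{lex}$-minimality is tested. -}

module Defs where

open import Level using (0ℓ)
open import Data.Nat using (ℕ; suc)
open import Data.Integer using (+_)
open import Data.Fin using (Fin; toℕ)
open import Data.Fin.Subset using (Subset; _∈_)
open import Data.Bool using (Bool; true; false; T)
open import Data.Product using (Σ; _×_; _,_; proj₁; proj₂)
open import Data.Sum using (_⊎_)
open import Data.Empty using (⊥)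
open import Relation.Nullary using (¬_)
open import Relation.Binary using (Rel; IsStrictTotalOrder)
open import Relation.Binary.PropositionalEquality using (_≡_; _≢_)
open import Data.Rational using (ℚ; _/_; _+_; _-_; 0ℚ; 1ℚ; _<_)
open import Function.Bundles using (_⇔_)
import Data.Fin as F

data Entry : Set where
  zer pos neg : Entry

data Sign : Set where
  plus minus : Sign

_·_ : Sign → Sign → Sign
plus  · s     = s
minus · plus  = minus
minus · minus = plus

signEntry : Sign → Entry
signEntry plus  = pos
signEntry minus = neg

isNonzero : Entry → Bool
isNonzero zer = false
isNonzero pos = true
isNonzero neg = true

-- Convention: `entry c r` is the cell in column c (counted left to right)
-- and row r (counted bottom to top) of the standard figure; the cell
-- occupies the unit square [c, c+1] × [r, r+1].
record PMM : Set where
  field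
    width height : ℕ
    entry  : Fin width → Fin height → Entry
    colSign : Fin width → Sign
    rowSign : Fin height → Sign
    compatible : ∀ c r → T (isNonzero (entry c r)) →
                 entry c r ≡ signEntry (rowSign r · colSign c)
open PMM public

Cell : PMM → Set
Cell M = Σ (Fin (width M) × Fin (height M)) λ cr → T (isNonzero (entry M (proj₁ cr) (proj₂ cr)))

col : {M : PMM} → Cell M → Fin (width M)
col ((c , r) , _) = c

row : {M : PMM} → Cell M → Fin (height M)
row ((c , r) , _) = r

_≺lex_ : {M : PMM} → Cell M → Cell M → Set
_≺lex_ {M} a b = (row {M} a F.< row {M} b) ⊎ ((row {M} a ≡ row {M} b) × (col {M} a F.< col {M} b))

record Perm (k : ℕ) : Set₁ where
  field
    _<₁_ : Rel (Fin k) 0ℓ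
    _<₂_ : Rel (Fin k) 0ℓ
    isLin₁ : IsStrictTotalOrder _≡_ _<₁_
    isLin₂ : IsStrictTotalOrder _≡_ _<₂_
open Perm public

ℕtoℚ : ℕ → ℚ
ℕtoℚ n = (+ n) / 1

-- A point of cell C at parameter t ∈ (0,1) on its open segment.
xCoord : {M : PMM} → Cell M → ℚ → ℚ
xCoord {M} C t = ℕtoℚ (toℕ (col {M} C)) + t

yCoord : {M : PMM} → Cell M → ℚ → ℚ
yCoord {M} ((c , r) , _) t with entry M c r
... | pos = ℕtoℚ (toℕ r) + t
... | neg = ℕtoℚ (toℕ r) + (1ℚ - t)
... | zer = ℕtoℚ (toℕ r)   -- unreachable for nonzero cells

Drawable : (M : PMM) {k : ℕ} → Perm k → (Fin k → Cell M) → Set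
Drawable M {k} π g =
  Σ (Fin k → ℚ) λ t →
    (∀ a → (0ℚ < t a) × (t a < 1ℚ)) ×
    (∀ a b → (_<₁_ π a b) ⇔ (xCoord {M} (g a) (t a) < xCoord {M} (g b) (t b))) ×
    (∀ a b → (_<₂_ π a b) ⇔ (yCoord {M} (g a) (t a) < yCoord {M} (g b) (t b)))

LexLess : (M : PMM) {k : ℕ} → Perm k → (Fin k → Cell M) → (Fin k → Cell M) → Set
LexLess M {k} π g h =
  Σ (Fin k) λ p → (g p ≢ h p) × (∀ q → _<₁_ π q p → g q ≡ h q) × (_≺lex_ {M} (g p) (h p))

LexMinimal : (M : PMM) {k : ℕ} → Perm k → (Fin k → Cell M) → Set
LexMinimal M π g = ∀ h → Drawable M π h → ¬ LexLess M π h g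

-- Monadic second-order logic over the language {<₁, <₂} ∪ L
-- (de Bruijn indices: e element variables, s set variables)

data MSO (L : Set) : ℕ → ℕ → Set where
  lt₁ lt₂ : ∀ {e s} → Fin e → Fin e → MSO L e s
  unary   : ∀ {e s} → L → Fin e → MSO L e s
  eqv     : ∀ {e s} → Fin e → Fin e → MSO L e s
  mem     : ∀ {e s} → Fin e → Fin s → MSO L e s
  not     : ∀ {e s} → MSO L e s → MSO L e s
  and or  : ∀ {e s} → MSO L e s → MSO L e s → MSO L e s
  exE allE : ∀ {e s} → MSO L (suc e) s → MSO L e s
  exS allS : ∀ {e s} → MSO L e (suc s) → MSO L e s

Sentence : Set → Set
Sentence L = MSO L 0 0

-- An M-gridded permutation: (π, <₁, <₂, C_1, …, C_n) on domain Fin k,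
-- the C_i given as the cell assignment g (so they partition the domain).
record Gridded (M : PMM) (k : ℕ) : Set₁ where
  constructor _,,_
  field
    perm : Perm k
    grid : Fin k → Cell M
open Gridded public

extend : ∀ {A : Set} {n} → (Fin n → A) → A → Fin (suc n) → A
extend ρ a F.zero = a
extend ρ a (F.suc i) = ρ i

Sat : {M : PMM} {k e s : ℕ} → Gridded M k → (Fin e → Fin k) → (Fin s → Subset k) → MSO (Cell M) e s → Set
Sat S ρ σ (lt₁ i j)   = _<₁_ (perm S) (ρ i) (ρ j)
Sat S ρ σ (lt₂ i j)   = _<₂_ (perm S) (ρ i) (ρ j)
Sat S ρ σ (unary C i) = grid S (ρ i) ≡ C
Sat S ρ σ (eqv i j)   = ρ i ≡ ρ j
Sat S ρ σ (mem i X)   = ρ i ∈ σ X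
Sat S ρ σ (not φ)     = ¬ Sat S ρ σ φ
Sat S ρ σ (and φ ψ)   = Sat S ρ σ φ × Sat S ρ σ ψ
Sat S ρ σ (or φ ψ)    = Sat S ρ σ φ ⊎ Sat S ρ σ ψ
Sat {k = k} S ρ σ (exE φ)  = Σ (Fin k) λ a → Sat S (extend ρ a) σ φ
Sat {k = k} S ρ σ (allE φ) = ∀ (a : Fin k) → Sat S (extend ρ a) σ φ
Sat {k = k} S ρ σ (exS φ)  = Σ (Subset k) λ X → Sat S ρ (extend σ X) φ
Sat {k = k} S ρ σ (allS φ) = ∀ (X : Subset k) → Sat S ρ (extend σ X) φ

_⊨_ : {M : PMM} {k : ℕ} → Gridded M k → Sentence (Cell M) → Set
S ⊨ φ = Sat S (λ ()) (λ ()) φ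

{-# OPTIONS --safe #-}
-- A gridding h of π is described by one set of points per column and one per row, so MSO can
-- quantify over griddings, and Min says that no such sets describe a drawable gridding that is
-- <lex-below the given one.  What must be expressed is drawability.  Place each point a at
-- parameter D a ∈ (0,1) of its segment, read in the direction of its column's sign; since M is a
-- partial multiplication matrix, the same parameter is then read in the direction of its row's
-- sign.  So h is drawable iff (i) points in lower columns (rows) come first in <₁ (<₂), and
-- (ii) the relation "z and m share a column (row) and are ordered by <₁ (<₂) in the direction of
-- its sign", which forces D z < D m, is acyclic.  On a finite set acyclicity means that every
-- nonempty subset has a minimal element, which is MSO; conversely, ranking an acyclic relation
-- and mapping ranks monotonically into (0,1) produces the parameters.
module Submission where

open import Defs
open import Level using (0ℓ)
open import Data.Nat as ℕ using (ℕ; zero; suc; z≤n; s≤s)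
import Data.Nat.Properties as ℕP
import Data.Nat.Coprimality as Coprime
import Data.Integer as ℤ
import Data.Integer.Properties as ℤP
open import Data.Rational as ℚ using (ℚ; 0ℚ; 1ℚ; ½; _+_; _-_; -_; _*_; _<_; _≤_; mkℚ)
import Data.Rational.Properties as ℚP
import Data.Rational.Unnormalised as ℚᵘ
import Data.Rational.Unnormalised.Properties as ℚᵘP
open import Data.Fin as F using (Fin; toℕ; _↑ˡ_; _↑ʳ_)
import Data.Fin.Properties as FP
open import Relation.Binary using (Rel; DecTotalOrder; IsStrictTotalOrder; tri<; tri≈; tri>)
open import Data.Fin.Subset as Subset using (Subset; _∈_; Nonempty; ∣_∣)
open import Data.Fin.Subset.Properties using (_∈?_; nonempty?; ∈⊤; ∣p∣≤n; x∈p⇒∣p-x∣<∣p∣; x∈p∧x≢y⇒x∈p-y)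
open import Data.List using (filter; allFin)
open import Data.List.Relation.Unary.All as All using ()
open import Data.List.Relation.Unary.All.Properties using (all-filter)
open import Data.List.Membership.Propositional.Properties using (∈-filter⁺; ∈-allFin)
open import Data.List.Extrema (DecTotalOrder.totalOrder ℚP.≤-decTotalOrder) using (argmin; argmin-all; f[argmin]≤f[xs])
open import Data.Bool using (T)
open import Data.Bool.Properties using (T-irrelevant)
open import Data.Vec.Functional using (_∷_)
import Data.Vec as Vec
import Data.Vec.Properties as VecP
open import Data.Product using (Σ; _×_; _,_; proj₁; proj₂)
open import Data.Sum as Sum using (_⊎_; inj₁; inj₂; [_,_])
open import Data.Empty using (⊥-elim)
open import Relation.Nullary using (¬_; Dec; yes; no; does; ¬?)
open import Relation.Nullary.Decidable using (_×-dec_; _⊎-dec_; decidable-stable; dec-true)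
open import Relation.Binary.PropositionalEquality hiding ([_])
open import Function.Base using (_on_; _∘_; id)
open import Function.Bundles using (_⇔_; mk⇔; Equivalence)
open Equivalence using (to; from)
open import Algebra.Properties.AbelianGroup ℚP.+-0-abelianGroup using (⁻¹-anti-homo‿-; xyx⁻¹≈y)

ℕtoℚ≡mkℚ : ∀ n → ℕtoℚ n ≡ mkℚ (ℤ.+ n) 0 (Coprime.sym (Coprime.1-coprimeTo n))
ℕtoℚ≡mkℚ n = ℚP.normalize-coprime (Coprime.sym (Coprime.1-coprimeTo n))

ℕtoℚ-suc : ∀ n → ℕtoℚ (suc n) ≡ ℕtoℚ n + 1ℚ
ℕtoℚ-suc n = ℚP.toℚᵘ-injective (ℚᵘP.≃-trans lhs (ℚᵘP.≃-sym (ℚP.toℚᵘ-homo-+ (ℕtoℚ n) 1ℚ)))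
  where
  lhs : ℚ.toℚᵘ (ℕtoℚ (suc n)) ℚᵘ.≃ ℚ.toℚᵘ (ℕtoℚ n) ℚᵘ.+ ℚ.toℚᵘ 1ℚ
  lhs rewrite ℕtoℚ≡mkℚ (suc n) | ℕtoℚ≡mkℚ n = ℚᵘ.*≡* (begin
    ℤ.+ suc n ℤ.* ℤ.+ 1                 ≡⟨ ℤP.*-identityʳ (ℤ.+ suc n) ⟩
    ℤ.+ suc n                            ≡⟨ cong ℤ.+_ (ℕP.+-comm 1 n) ⟩
    ℤ.+ (n ℕ.+ 1)                        ≡⟨ cong (ℤ._+ ℤ.+ 1) (ℤP.*-identityʳ (ℤ.+ n)) ⟨
    (ℤ.+ n ℤ.* ℤ.+ 1 ℤ.+ ℤ.+ 1)          ≡⟨ ℤP.*-identityʳ _ ⟨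
    (ℤ.+ n ℤ.* ℤ.+ 1 ℤ.+ ℤ.+ 1) ℤ.* ℤ.+ 1 ∎)
    where open ≡-Reasoning

ℕtoℚ-mono-≤ : ∀ {m n} → m ℕ.≤ n → ℕtoℚ m ≤ ℕtoℚ n
ℕtoℚ-mono-≤ {m} {n} m≤n rewrite ℕtoℚ≡mkℚ m | ℕtoℚ≡mkℚ n =
  ℚ.*≤* (ℤP.*-monoʳ-≤-nonNeg (ℤ.+ 1) (ℤ.+≤+ m≤n))

InUnit : ℚ → Set
InUnit t = 0ℚ < t × t < 1ℚ

lane-< : ∀ {c c' u u'} → c ℕ.< c' → InUnit u → InUnit u' → ℕtoℚ c + u < ℕtoℚ c' + u'
lane-< {c} {c'} {u} {u'} c<c' (_ , u<1) (0<u' , _) = begin-strict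
  ℕtoℚ c + u    <⟨ ℚP.+-monoʳ-< (ℕtoℚ c) u<1 ⟩
  ℕtoℚ c + 1ℚ   ≡⟨ ℕtoℚ-suc c ⟨
  ℕtoℚ (suc c)  ≤⟨ ℕtoℚ-mono-≤ c<c' ⟩
  ℕtoℚ c'       ≡⟨ ℚP.+-identityʳ (ℕtoℚ c') ⟨
  ℕtoℚ c' + 0ℚ  <⟨ ℚP.+-monoʳ-< (ℕtoℚ c') 0<u' ⟩
  ℕtoℚ c' + u'  ∎
  where open ℚP.≤-Reasoning

strictTotal⊆asym⇒⊇ : ∀ {A : Set} {R S : Rel A 0ℓ} → IsStrictTotalOrder _≡_ R →
  (∀ {a b} → S a b → ¬ S b a) → (∀ {a b} → R a b → S a b) → ∀ {a b} → S a b → R a b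
strictTotal⊆asym⇒⊇ R-sto S-asym R⊆S {a} {b} Sab with IsStrictTotalOrder.compare R-sto a b
... | tri< Rab _ _ = Rab
... | tri≈ _ refl _ = ⊥-elim (S-asym Sab Sab)
... | tri> _ _ Rba = ⊥-elim (S-asym Sab (R⊆S Rba))

+-cancelˡ-< : ∀ p {x y} → p + x < p + y → x < y
+-cancelˡ-< p = strictTotal⊆asym⇒⊇ ℚP.<-isStrictTotalOrder ℚP.<-asym (ℚP.+-monoʳ-< p)

orient : Sign → ℚ → ℚ
orient plus  u = u
orient minus u = 1ℚ - u

Oriented : ∀ {A : Set} → Sign → Rel A 0ℓ → Rel A 0ℓ
Oriented plus  R a b = R a b
Oriented minus R a b = R b a

orient-involutive : ∀ s u → orient s (orient s u) ≡ u
orient-involutive plus  u = refl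
orient-involutive minus u = begin
  1ℚ - (1ℚ - u)  ≡⟨ cong (1ℚ +_) (⁻¹-anti-homo‿- 1ℚ u) ⟩
  1ℚ + (u - 1ℚ)  ≡⟨ ℚP.+-assoc 1ℚ u (- 1ℚ) ⟨
  1ℚ + u - 1ℚ    ≡⟨ xyx⁻¹≈y 1ℚ u ⟩
  u              ∎
  where open ≡-Reasoning

orient-· : ∀ s s' u → orient (s · s') (orient s' u) ≡ orient s u
orient-· plus  s'    u = orient-involutive s' u
orient-· minus plus  u = refl
orient-· minus minus u = refl

orient-mono : ∀ s {u v} → Oriented s _<_ u v → orient s u < orient s v
orient-mono plus  u<v = u<v
orient-mono minus v<u = ℚP.+-monoʳ-< 1ℚ (ℚP.neg-antimono-< v<u)

orient-reflects : ∀ s {u v} → orient s u < orient s v → Oriented s _<_ u v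
orient-reflects plus  u<v = u<v
orient-reflects minus {u} {v} h =
  subst₂ _<_ (orient-involutive minus v) (orient-involutive minus u) (orient-mono minus h)

orient-inUnit : ∀ s {u} → InUnit u → InUnit (orient s u)
orient-inUnit plus  u∈ = u∈
orient-inUnit minus {u} (0<u , u<1) =
  subst (_< 1ℚ - u) (ℚP.+-inverseʳ 1ℚ) (orient-mono minus u<1) , orient-mono minus 0<u

sameLane-< : ∀ c s {A : Set} (D : A → ℚ) {a b} →
             (ℕtoℚ c + orient s (D a) < ℕtoℚ c + orient s (D b)) ⇔ Oriented s (_<_ on D) a b
sameLane-< c plus  D = mk⇔ (+-cancelˡ-< (ℕtoℚ c)) (ℚP.+-monoʳ-< (ℕtoℚ c))
sameLane-< c minus D = mk⇔ (λ h → orient-reflects minus (+-cancelˡ-< (ℕtoℚ c) h))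
                           (λ o → ℚP.+-monoʳ-< (ℕtoℚ c) (orient-mono minus o))

Oriented-intro : ∀ {A : Set} {R S : Rel A 0ℓ} s {a b} →
  (Oriented s R a b → S a b) → (Oriented s R b a → S b a) → R a b → Oriented s S a b
Oriented-intro plus  f g r = f r
Oriented-intro minus f g r = g r

Oriented-elim : ∀ {A : Set} {R S : Rel A 0ℓ} s {a b} →
  (R a b → Oriented s S a b) → (R b a → Oriented s S b a) → Oriented s R a b → S a b
Oriented-elim plus  f g r = f r
Oriented-elim minus f g r = g r

rung : ℕ → ℚ
rung zero    = ½
rung (suc n) = (rung n + 1ℚ) * ½

halve-double : ∀ x → (x + x) * ½ ≡ x
halve-double x = begin
  (x + x) * ½    ≡⟨ ℚP.*-distribʳ-+ ½ x x ⟩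
  x * ½ + x * ½  ≡⟨ ℚP.*-distribˡ-+ x ½ ½ ⟨
  x * (½ + ½)    ≡⟨ ℚP.*-identityʳ x ⟩
  x              ∎
  where open ≡-Reasoning

midpoint-to-1 : ∀ {x} → x < 1ℚ → x < (x + 1ℚ) * ½ × (x + 1ℚ) * ½ < 1ℚ
midpoint-to-1 {x} x<1 =
  subst (_< (x + 1ℚ) * ½) (halve-double x) (ℚP.*-monoˡ-<-pos ½ (ℚP.+-monoʳ-< x x<1)) ,
  subst ((x + 1ℚ) * ½ <_) (halve-double 1ℚ) (ℚP.*-monoˡ-<-pos ½ (ℚP.+-monoˡ-< 1ℚ x<1))

rung-inUnit : ∀ n → InUnit (rung n)
rung-inUnit zero    = ℚ.*<* (ℤ.+<+ (s≤s z≤n)) , ℚ.*<* (ℤ.+<+ (s≤s (s≤s z≤n)))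
rung-inUnit (suc n) =
  let (0<r , r<1) = rung-inUnit n
      (r<r' , r'<1) = midpoint-to-1 r<1
  in ℚP.<-trans 0<r r<r' , r'<1

rung-suc : ∀ n → rung n < rung (suc n)
rung-suc n = proj₁ (midpoint-to-1 (proj₂ (rung-inUnit n)))

rung-mono : ∀ {m n} → m ℕ.< n → rung m < rung n
rung-mono {m} {suc n} (s≤s m≤n) with ℕP.m≤n⇒m<n∨m≡n m≤n
... | inj₁ m<n  = ℚP.<-trans (rung-mono m<n) (rung-suc n)
... | inj₂ refl = rung-suc n

-- A lane is a column (ordered by <₁) or a row (ordered by <₂) of the standard figure.
module Lanes {k n} (_≺_ : Rel (Fin k) 0ℓ) (≺-sto : IsStrictTotalOrder _≡_ _≺_)
             (lane : Fin k → Fin n) (sign : Fin n → Sign) where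

  LanesSeparated : Set
  LanesSeparated = ∀ a b → lane a F.< lane b → a ≺ b

  LanePrec : Rel (Fin k) 0ℓ
  LanePrec z m = Σ (Fin n) λ c → lane z ≡ c × lane m ≡ c × Oriented (sign c) _≺_ z m

  module _ (D : Fin k → ℚ) (D∈ : ∀ a → InUnit (D a)) where

    coord : Fin k → ℚ
    coord a = ℕtoℚ (toℕ (lane a)) + orient (sign (lane a)) (D a)

    Represents : Set
    Represents = ∀ a b → a ≺ b ⇔ coord a < coord b

    coord-separates : ∀ {a b} → lane a F.< lane b → coord a < coord b
    coord-separates {a} {b} lt =
      lane-< lt (orient-inUnit (sign (lane a)) (D∈ a)) (orient-inUnit (sign (lane b)) (D∈ b))

    coord-sameLane : ∀ {a b c} → lane a ≡ c → lane b ≡ c →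
                     coord a < coord b ⇔ Oriented (sign c) (_<_ on D) a b
    coord-sameLane {a} {b} {c} ac bc = subst₂
      (λ x y → ℕtoℚ (toℕ x) + orient (sign x) (D a) < ℕtoℚ (toℕ y) + orient (sign y) (D b)
               ⇔ Oriented (sign c) (_<_ on D) a b)
      (sym ac) (sym bc) (sameLane-< (toℕ c) (sign c) D)

    represents⇒separated : Represents → LanesSeparated
    represents⇒separated rep a b lt = from (rep a b) (coord-separates lt)

    represents⇒prec-mono : Represents → ∀ z m → LanePrec z m → D z < D m
    represents⇒prec-mono rep z m (c , zc , mc , o) = Oriented-elim (sign c)
      (λ z≺m → to (coord-sameLane zc mc) (to (rep z m) z≺m))
      (λ m≺z → to (coord-sameLane mc zc) (to (rep m z) m≺z)) o

    separated∧prec-mono⇒represents : LanesSeparated → (∀ z m → LanePrec z m → D z < D m) → Represents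
    separated∧prec-mono⇒represents sep mono a b =
      mk⇔ ≺⇒< (strictTotal⊆asym⇒⊇ ≺-sto ℚP.<-asym ≺⇒<)
      where
      ≺⇒< : ∀ {a b} → a ≺ b → coord a < coord b
      ≺⇒< {a} {b} a≺b with FP.<-cmp (lane a) (lane b)
      ... | tri< lt _ _ = coord-separates lt
      ... | tri> _ _ gt = ⊥-elim (IsStrictTotalOrder.asym ≺-sto a≺b (sep b a gt))
      ... | tri≈ _ eq _ = from (coord-sameLane refl (sym eq)) (Oriented-intro (sign (lane a))
            (λ o → mono a b (lane a , refl , sym eq , o))
            (λ o → mono b a (lane a , sym eq , refl , o)) a≺b)

-- Over a finite carrier this is equivalent to acyclicity; it is the form that MSO can express.
Acyclic : ∀ {k} → Rel (Fin k) 0ℓ → Set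
Acyclic {k} R = ∀ Z → Nonempty Z → Σ (Fin k) λ m → m ∈ Z × (∀ z → z ∈ Z → ¬ R z m)

monotone⇒acyclic : ∀ {k} {R : Rel (Fin k) 0ℓ} (D : Fin k → ℚ) → (∀ a b → R a b → D a < D b) → Acyclic R
monotone⇒acyclic {k} D mono Z (a , a∈Z) =
  m , m∈Z , λ z z∈Z Rzm → ℚP.<-irrefl refl (ℚP.<-≤-trans (mono z m Rzm) (Dm≤ z z∈Z))
  where
  members = filter (_∈? Z) (allFin k)
  m = argmin D a members
  m∈Z : m ∈ Z
  m∈Z = argmin-all D a∈Z (all-filter (_∈? Z) (allFin k))
  Dm≤ : ∀ z → z ∈ Z → D m ≤ D z
  Dm≤ z z∈Z = All.lookup (f[argmin]≤f[xs] a members) (∈-filter⁺ (_∈? Z) (∈-allFin z) z∈Z)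

RankingOn : ∀ {k} → Rel (Fin k) 0ℓ → Subset k → Set
RankingOn {k} R Z = Σ (Fin k → ℕ) λ f → ∀ a b → a ∈ Z → b ∈ Z → R a b → f a ℕ.< f b

module _ {k} {R : Rel (Fin k) 0ℓ} (acyclic : Acyclic R) where

  private
    rankOn : ∀ fuel Z → ∣ Z ∣ ℕ.< fuel → RankingOn R Z
    peel : ∀ fuel Z → ∣ Z ∣ ℕ.< fuel → (Σ (Fin k) λ m → m ∈ Z × (∀ z → z ∈ Z → ¬ R z m)) → RankingOn R Z

    rankOn fuel Z bound with nonempty? Z
    ... | no ∅   = (λ _ → 0) , λ a _ a∈Z _ _ → ⊥-elim (∅ (a , a∈Z))
    ... | yes ne = peel fuel Z bound (acyclic Z ne)

    peel (suc fuel) Z (s≤s ∣Z∣≤fuel) (m , m∈Z , m-minimal) = f , mono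
      where
      rest : RankingOn R (Z Subset.- m)
      rest = rankOn fuel (Z Subset.- m) (ℕP.<-≤-trans (x∈p⇒∣p-x∣<∣p∣ m∈Z) ∣Z∣≤fuel)
      f : Fin k → ℕ
      f y with y F.≟ m
      ... | yes _ = 0
      ... | no  _ = suc (proj₁ rest y)
      mono : ∀ a b → a ∈ Z → b ∈ Z → R a b → f a ℕ.< f b
      mono a b a∈Z b∈Z Rab with a F.≟ m | b F.≟ m
      ... | _      | yes refl = ⊥-elim (m-minimal a a∈Z Rab)
      ... | yes _  | no _     = s≤s z≤n
      ... | no a≢m | no b≢m   =
        s≤s (proj₂ rest a b (x∈p∧x≢y⇒x∈p-y a∈Z a≢m) (x∈p∧x≢y⇒x∈p-y b∈Z b≢m) Rab)

  acyclic⇒ranking : Σ (Fin k → ℕ) λ f → ∀ a b → R a b → f a ℕ.< f b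
  acyclic⇒ranking =
    let (f , mono) = rankOn (suc k) Subset.⊤ (s≤s (∣p∣≤n Subset.⊤)) in f , λ a b → mono a b ∈⊤ ∈⊤

  acyclic⇒unitParams : Σ (Fin k → ℚ) λ D → (∀ a → InUnit (D a)) × (∀ a b → R a b → D a < D b)
  acyclic⇒unitParams =
    let (f , mono) = acyclic⇒ranking in
    (λ a → rung (f a)) , (λ a → rung-inUnit (f a)) , λ a b Rab → rung-mono (mono a b Rab)

cell-≡ : ∀ {M} {C C' : Cell M} → col {M} C ≡ col {M} C' → row {M} C ≡ row {M} C' → C ≡ C'
cell-≡ {C = (c , r) , p} {(.c , .r) , q} refl refl = cong ((c , r) ,_) (T-irrelevant p q)

-- By `compatible`, the segment of cell (c, r) rises exactly when rowSign r · colSign c is plus.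
yCoord-orient : ∀ {M} (C : Cell M) t →
  yCoord {M} C t ≡ ℕtoℚ (toℕ (row {M} C)) + orient (rowSign M (row {M} C) · colSign M (col {M} C)) t
yCoord-orient {M} ((c , r) , nz) t with entry M c r | nz | compatible M c r nz
... | pos | _ | eq with rowSign M r · colSign M c
...   | plus  = refl
...   | minus with eq
...     | ()
yCoord-orient {M} ((c , r) , nz) t | neg | _ | eq with rowSign M r · colSign M c
...   | minus = refl
...   | plus  with eq
...     | ()

module Gridding (M : PMM) {k} (π : Perm k) (h : Fin k → Cell M) where

  colOf : Fin k → Fin (width M)
  colOf a = col {M} (h a)

  rowOf : Fin k → Fin (height M)
  rowOf a = row {M} (h a)

  module X = Lanes (_<₁_ π) (isLin₁ π) colOf (colSign M)
  module Y = Lanes (_<₂_ π) (isLin₂ π) rowOf (rowSign M)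

  Separated : Set
  Separated = X.LanesSeparated × Y.LanesSeparated

  ParamPrec : Rel (Fin k) 0ℓ
  ParamPrec z m = X.LanePrec z m ⊎ Y.LanePrec z m

  module _ (D : Fin k → ℚ) (D∈ : ∀ a → InUnit (D a)) where

    drawnAt : Fin k → ℚ
    drawnAt a = orient (colSign M (colOf a)) (D a)

    yCoord-drawnAt : ∀ a → yCoord {M} (h a) (drawnAt a) ≡ Y.coord D D∈ a
    yCoord-drawnAt a = trans (yCoord-orient (h a) (drawnAt a))
      (cong (ℕtoℚ (toℕ (rowOf a)) +_) (orient-· (rowSign M (rowOf a)) (colSign M (colOf a)) (D a)))

    represents⇒drawable : X.Represents D D∈ → Y.Represents D D∈ → Drawable M π h
    represents⇒drawable xRep yRep =
      drawnAt , (λ a → orient-inUnit (colSign M (colOf a)) (D∈ a)) , xRep ,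
      λ a b → subst₂ (λ u v → _<₂_ π a b ⇔ u < v) (sym (yCoord-drawnAt a)) (sym (yCoord-drawnAt b)) (yRep a b)

  drawable⇒represents : Drawable M π h →
    Σ (Fin k → ℚ) λ D → Σ (∀ a → InUnit (D a)) λ D∈ → X.Represents D D∈ × Y.Represents D D∈
  drawable⇒represents (t , t∈ , x⇔ , y⇔) = D , D∈ , xRep , yRep
    where
    D : Fin k → ℚ
    D a = orient (colSign M (colOf a)) (t a)
    D∈ : ∀ a → InUnit (D a)
    D∈ a = orient-inUnit (colSign M (colOf a)) (t∈ a)
    t≡drawnAt : ∀ a → t a ≡ drawnAt D D∈ a
    t≡drawnAt a = sym (orient-involutive (colSign M (colOf a)) (t a))
    xRep : X.Represents D D∈
    xRep a b = subst₂ (λ u v → _<₁_ π a b ⇔ xCoord {M} (h a) u < xCoord {M} (h b) v)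
                      (t≡drawnAt a) (t≡drawnAt b) (x⇔ a b)
    yRep : Y.Represents D D∈
    yRep a b = subst₂ (λ u v → _<₂_ π a b ⇔ u < v)
      (trans (cong (yCoord {M} (h a)) (t≡drawnAt a)) (yCoord-drawnAt D D∈ a))
      (trans (cong (yCoord {M} (h b)) (t≡drawnAt b)) (yCoord-drawnAt D D∈ b)) (y⇔ a b)

  drawable⇒separated : Drawable M π h → Separated
  drawable⇒separated dr =
    let (D , D∈ , xRep , yRep) = drawable⇒represents dr
    in X.represents⇒separated D D∈ xRep , Y.represents⇒separated D D∈ yRep

  drawable⇒acyclic : Drawable M π h → Acyclic ParamPrec
  drawable⇒acyclic dr =
    let (D , D∈ , xRep , yRep) = drawable⇒represents dr
    in monotone⇒acyclic D λ z m →
         [ X.represents⇒prec-mono D D∈ xRep z m , Y.represents⇒prec-mono D D∈ yRep z m ]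

  separated∧acyclic⇒drawable : Separated → Acyclic ParamPrec → Drawable M π h
  separated∧acyclic⇒drawable (xSep , ySep) acyclic =
    let (D , D∈ , mono) = acyclic⇒unitParams acyclic
    in represents⇒drawable D D∈
         (X.separated∧prec-mono⇒represents D D∈ xSep λ z m p → mono z m (inj₁ p))
         (Y.separated∧prec-mono⇒represents D D∈ ySep λ z m p → mono z m (inj₂ p))

module _ {L : Set} {e s : ℕ} where

  ⊥ᶠ ⊤ᶠ : MSO L e s
  ⊥ᶠ = exE (not (eqv F.zero F.zero))
  ⊤ᶠ = not ⊥ᶠ

  infixr 5 _⇒ᶠ_
  _⇒ᶠ_ : MSO L e s → MSO L e s → MSO L e s
  φ ⇒ᶠ ψ = or (not φ) ψ

  ⋁ᶠ ⋀ᶠ : ∀ m → (Fin m → MSO L e s) → MSO L e s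
  ⋁ᶠ zero    φ = ⊥ᶠ
  ⋁ᶠ (suc m) φ = or (φ F.zero) (⋁ᶠ m (φ ∘ F.suc))
  ⋀ᶠ zero    φ = ⊤ᶠ
  ⋀ᶠ (suc m) φ = and (φ F.zero) (⋀ᶠ m (φ ∘ F.suc))

  ⟨_⟩⇒ᶠ_ ⟨_⟩∧ᶠ_ : ∀ {P : Set} → Dec P → MSO L e s → MSO L e s
  ⟨ yes _ ⟩⇒ᶠ φ = φ
  ⟨ no  _ ⟩⇒ᶠ φ = ⊤ᶠ
  ⟨ yes _ ⟩∧ᶠ φ = φ
  ⟨ no  _ ⟩∧ᶠ φ = ⊥ᶠ

  orientedᶠ : Sign → (Fin e → Fin e → MSO L e s) → Fin e → Fin e → MSO L e s
  orientedᶠ plus  R x y = R x y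
  orientedᶠ minus R x y = R y x

¬⊎⇔→ : ∀ {A B : Set} → Dec A → (¬ A ⊎ B) ⇔ (A → B)
¬⊎⇔→ (yes a) = mk⇔ (λ { (inj₁ ¬a) a → ⊥-elim (¬a a) ; (inj₂ b) _ → b }) (λ f → inj₂ (f a))
¬⊎⇔→ (no ¬a) = mk⇔ (λ _ a → ⊥-elim (¬a a)) (λ _ → inj₁ ¬a)

∀ˢ : ∀ {L e} m → MSO L e m → MSO L e 0
∀ˢ zero    φ = φ
∀ˢ (suc m) φ = ∀ˢ m (allS φ)

-- Rebuilds τ by the same iterated `extend` that the semantics of allS performs,
-- so that valuations of ∀ˢ-bound variables compute.
expand : ∀ {A : Set} {m} → (Fin 0 → A) → (Fin m → A) → Fin m → A
expand {m = zero}  σ₀ τ = σ₀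
expand {m = suc m} σ₀ τ = extend (expand σ₀ (τ ∘ F.suc)) (τ F.zero)

expand-≡ : ∀ {A : Set} {m} (σ₀ : Fin 0 → A) (τ : Fin m → A) i → expand σ₀ τ i ≡ τ i
expand-≡ σ₀ τ F.zero    = refl
expand-≡ σ₀ τ (F.suc i) = expand-≡ σ₀ (τ ∘ F.suc) i

LaneEncodes : ∀ {k s n} → (Fin s → Subset k) → (Fin n → Fin s) → (Fin k → Fin n) → Set
LaneEncodes σ sets lane = ∀ a i → a ∈ σ (sets i) ⇔ lane a ≡ i

laneSet : ∀ {k n} → (Fin k → Fin n) → Fin n → Subset k
laneSet lane i = Vec.tabulate λ a → does (lane a F.≟ i)

laneSet-encodes : ∀ {k n} (lane : Fin k → Fin n) → LaneEncodes (laneSet lane) id lane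
laneSet-encodes lane a i = mk⇔ ∈⇒≡ ≡⇒∈
  where
  ∈⇒≡ : a ∈ laneSet lane i → lane a ≡ i
  ∈⇒≡ a∈ with lane a F.≟ i | trans (sym (VecP.lookup∘tabulate _ a)) (VecP.[]=⇒lookup a∈)
  ... | yes eq | _ = eq
  ... | no _   | ()
  ≡⇒∈ : lane a ≡ i → a ∈ laneSet lane i
  ≡⇒∈ eq = VecP.lookup⇒[]= a _ (trans (VecP.lookup∘tabulate _ a) (dec-true (lane a F.≟ i) eq))

module _ {k s n} (σ : Fin s → Subset k) (sets : Fin n → Fin s) where

  inOneLane⇒laneEncodes : ∀ lane → (∀ a → a ∈ σ (sets (lane a))) →
    (∀ a i j → a ∈ σ (sets i) → a ∈ σ (sets j) → i ≡ j) → LaneEncodes σ sets lane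
  inOneLane⇒laneEncodes lane inLane unique a i =
    mk⇔ (λ a∈ᵢ → unique a (lane a) i (inLane a) a∈ᵢ) (λ { refl → inLane a })

  laneEncodes⇒inOneLane : ∀ {lane} → LaneEncodes σ sets lane →
    (∀ a → a ∈ σ (sets (lane a))) × (∀ a i j → a ∈ σ (sets i) → a ∈ σ (sets j) → i ≡ j)
  laneEncodes⇒inOneLane enc =
    (λ a → from (enc a _) refl) , λ a i j a∈ᵢ a∈ⱼ → trans (sym (to (enc a i) a∈ᵢ)) (to (enc a j) a∈ⱼ)

module _ {L : Set} {s n : ℕ} (sets : Fin n → Fin s) where

  inOneLaneᶠ : ∀ {e} → Fin e → MSO L e s
  inOneLaneᶠ x = ⋀ᶠ n λ i → ⋀ᶠ n λ j → ⟨ ¬? (i F.≟ j) ⟩⇒ᶠ not (and (mem x (sets i)) (mem x (sets j)))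

  orderedByLanesᶠ : ∀ {e} → (Fin (suc (suc e)) → Fin (suc (suc e)) → MSO L (suc (suc e)) s) →
                    Fin n → Fin n → MSO L (suc (suc e)) s
  orderedByLanesᶠ R i j = and (mem (F.suc F.zero) (sets i)) (mem F.zero (sets j)) ⇒ᶠ R (F.suc F.zero) F.zero

  lanesSeparatedᶠ : ∀ {e} → (∀ {e} → Fin e → Fin e → MSO L e s) → MSO L e s
  lanesSeparatedᶠ R = allE (allE (⋀ᶠ n λ i → ⋀ᶠ n λ j → ⟨ i F.<? j ⟩⇒ᶠ orderedByLanesᶠ R i j))

  orientedInLaneᶠ : ∀ {e} → (Fin n → Sign) → (Fin e → Fin e → MSO L e s) → Fin e → Fin e → Fin n → MSO L e s
  orientedInLaneᶠ sign R z m i = and (mem z (sets i)) (and (mem m (sets i)) (orientedᶠ (sign i) R z m))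

  lanePrecᶠ : ∀ {e} → (Fin n → Sign) → (Fin e → Fin e → MSO L e s) → Fin e → Fin e → MSO L e s
  lanePrecᶠ sign R z m = ⋁ᶠ n (orientedInLaneᶠ sign R z m)

module Semantics {M : PMM} {k : ℕ} (S : Gridded M k) where

  module _ {e s} {ρ : Fin e → Fin k} {σ : Fin s → Subset k} where

    ⊥ᶠ-sat : ¬ Sat S ρ σ ⊥ᶠ
    ⊥ᶠ-sat (_ , a≢a) = a≢a refl

    ⊤ᶠ-sat : Sat S ρ σ ⊤ᶠ
    ⊤ᶠ-sat = ⊥ᶠ-sat

    ⋁ᶠ-sat : ∀ m φ → Sat S ρ σ (⋁ᶠ m φ) ⇔ Σ (Fin m) λ i → Sat S ρ σ (φ i)
    ⋁ᶠ-sat zero    φ = mk⇔ (λ ⊥ → ⊥-elim (⊥ᶠ-sat ⊥)) (λ ())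
    ⋁ᶠ-sat (suc m) φ = mk⇔
      (λ { (inj₁ φ₀) → F.zero , φ₀
         ; (inj₂ φ′) → let (i , φᵢ) = to (⋁ᶠ-sat m (φ ∘ F.suc)) φ′ in F.suc i , φᵢ })
      (λ { (F.zero , φ₀) → inj₁ φ₀ ; (F.suc i , φᵢ) → inj₂ (from (⋁ᶠ-sat m (φ ∘ F.suc)) (i , φᵢ)) })

    ⋀ᶠ-sat : ∀ m φ → Sat S ρ σ (⋀ᶠ m φ) ⇔ (∀ i → Sat S ρ σ (φ i))
    ⋀ᶠ-sat zero    φ = mk⇔ (λ _ ()) (λ _ → ⊤ᶠ-sat)
    ⋀ᶠ-sat (suc m) φ = mk⇔
      (λ { (φ₀ , φ′) F.zero → φ₀ ; (φ₀ , φ′) (F.suc i) → to (⋀ᶠ-sat m (φ ∘ F.suc)) φ′ i })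
      (λ all → all F.zero , from (⋀ᶠ-sat m (φ ∘ F.suc)) (all ∘ F.suc))

    ⟨⟩⇒ᶠ-sat : ∀ {P : Set} (P? : Dec P) φ → Sat S ρ σ (⟨ P? ⟩⇒ᶠ φ) ⇔ (P → Sat S ρ σ φ)
    ⟨⟩⇒ᶠ-sat (yes p) φ = mk⇔ (λ sat _ → sat) (λ f → f p)
    ⟨⟩⇒ᶠ-sat (no ¬p) φ = mk⇔ (λ _ p → ⊥-elim (¬p p)) (λ _ → ⊤ᶠ-sat)

    ⟨⟩∧ᶠ-sat : ∀ {P : Set} (P? : Dec P) φ → Sat S ρ σ (⟨ P? ⟩∧ᶠ φ) ⇔ (P × Sat S ρ σ φ)
    ⟨⟩∧ᶠ-sat (yes p) φ = mk⇔ (p ,_) proj₂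
    ⟨⟩∧ᶠ-sat (no ¬p) φ = mk⇔ (λ ⊥ → ⊥-elim (⊥ᶠ-sat ⊥)) (λ (p , _) → ⊥-elim (¬p p))

    orientedᶠ-sat : ∀ sgn (R : Fin e → Fin e → MSO (Cell M) e s) {Rₛ : Rel (Fin k) 0ℓ} →
      (∀ x y → Sat S ρ σ (R x y) ⇔ Rₛ (ρ x) (ρ y)) →
      ∀ x y → Sat S ρ σ (orientedᶠ sgn R x y) ⇔ Oriented sgn Rₛ (ρ x) (ρ y)
    orientedᶠ-sat plus  R R⇔ x y = R⇔ x y
    orientedᶠ-sat minus R R⇔ x y = R⇔ y x

  ∀ˢ-sat : ∀ {e} {ρ : Fin e → Fin k} {σ₀ : Fin 0 → Subset k} m φ →
           Sat S ρ σ₀ (∀ˢ m φ) ⇔ (∀ τ → Sat S ρ (expand σ₀ τ) φ)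
  ∀ˢ-sat zero    φ = mk⇔ (λ sat _ → sat) (λ all → all (λ ()))
  ∀ˢ-sat (suc m) φ = mk⇔
    (λ sat τ → to (∀ˢ-sat m (allS φ)) sat (τ ∘ F.suc) (τ F.zero))
    (λ all → from (∀ˢ-sat m (allS φ)) λ τ X → all (X ∷ τ))

  module _ {s n} (σ : Fin s → Subset k) (sets : Fin n → Fin s) where

    inOneLaneᶠ-sat : ∀ {e} {ρ : Fin e → Fin k} x →
      Sat S ρ σ (inOneLaneᶠ sets x) ⇔ (∀ i j → ρ x ∈ σ (sets i) → ρ x ∈ σ (sets j) → i ≡ j)
    inOneLaneᶠ-sat {ρ = ρ} x = mk⇔
      (λ sat i j xᵢ xⱼ → decidable-stable (i F.≟ j) λ i≢j →
        to (⟨⟩⇒ᶠ-sat (¬? (i F.≟ j)) _) (to (⋀ᶠ-sat n _) (to (⋀ᶠ-sat n _) sat i) j) i≢j (xᵢ , xⱼ))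
      (λ unique → from (⋀ᶠ-sat n _) λ i → from (⋀ᶠ-sat n _) λ j →
        from (⟨⟩⇒ᶠ-sat (¬? (i F.≟ j)) _) λ i≢j (xᵢ , xⱼ) → i≢j (unique i j xᵢ xⱼ))

    module _ {lane : Fin k → Fin n} (enc : LaneEncodes σ sets lane)
             (R : ∀ {e} → Fin e → Fin e → MSO (Cell M) e s) {Rₛ : Rel (Fin k) 0ℓ}
             (R-sat : ∀ {e} {ρ : Fin e → Fin k} x y → Sat S ρ σ (R x y) ⇔ Rₛ (ρ x) (ρ y)) where

      lanesSeparatedᶠ-sat : ∀ {e} {ρ : Fin e → Fin k} →
        Sat S ρ σ (lanesSeparatedᶠ sets R) ⇔ (∀ a b → lane a F.< lane b → Rₛ a b)
      lanesSeparatedᶠ-sat {ρ = ρ} = mk⇔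
        (λ sat a b lt → to (R-sat _ _) (to (¬⊎⇔→ (members? a b (lane a) (lane b)))
          (to (⟨⟩⇒ᶠ-sat (lane a F.<? lane b) (orderedByLanesᶠ sets R (lane a) (lane b)))
            (to (⋀ᶠ-sat n _) (to (⋀ᶠ-sat n _) (sat a b) (lane a)) (lane b)) lt)
          (from (enc a (lane a)) refl , from (enc b (lane b)) refl)))
        (λ sep a b → from (⋀ᶠ-sat n _) λ i → from (⋀ᶠ-sat n _) λ j →
          from (⟨⟩⇒ᶠ-sat (i F.<? j) (orderedByLanesᶠ sets R i j)) λ i<j →
            from (¬⊎⇔→ (members? a b i j)) λ (aᵢ , bⱼ) →
              from (R-sat _ _) (sep a b (subst₂ F._<_ (sym (to (enc a i) aᵢ)) (sym (to (enc b j) bⱼ)) i<j)))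
        where
        members? : ∀ a b i j → Dec (a ∈ σ (sets i) × b ∈ σ (sets j))
        members? a b i j = (a ∈? σ (sets i)) ×-dec (b ∈? σ (sets j))

      lanePrecᶠ-sat : ∀ {e} {ρ : Fin e → Fin k} (sign : Fin n → Sign) z m →
        Sat S ρ σ (lanePrecᶠ sets sign R z m) ⇔
        Σ (Fin n) λ c → lane (ρ z) ≡ c × lane (ρ m) ≡ c × Oriented (sign c) Rₛ (ρ z) (ρ m)
      lanePrecᶠ-sat {ρ = ρ} sign z m = mk⇔
        (λ sat → let (c , z∈ , m∈ , o) = to (⋁ᶠ-sat n (orientedInLaneᶠ sets sign R z m)) sat in
          c , to (enc (ρ z) c) z∈ , to (enc (ρ m) c) m∈ , to (orientedᶠ-sat (sign c) R R-sat z m) o)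
        (λ (c , zc , mc , o) → from (⋁ᶠ-sat n _)
          (c , from (enc (ρ z) c) zc , from (enc (ρ m) c) mc , from (orientedᶠ-sat (sign c) R R-sat z m) o))

module MinSentence (M : PMM) where

  _≺lex?_ : ∀ C C' → Dec (_≺lex_ {M} C C')
  C ≺lex? C' = (row {M} C F.<? row {M} C') ⊎-dec
                ((row {M} C F.≟ row {M} C') ×-dec (col {M} C F.<? col {M} C'))

  ifNonzeroᶠ : ∀ {e s} x → (T (isNonzero x) → MSO (Cell M) e s) → MSO (Cell M) e s
  ifNonzeroᶠ zer φ = ⊥ᶠ
  ifNonzeroᶠ pos φ = φ _
  ifNonzeroᶠ neg φ = φ _

  ⋁cellsᶠ : ∀ {e s} → (Cell M → MSO (Cell M) e s) → MSO (Cell M) e s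
  ⋁cellsᶠ φ = ⋁ᶠ (width M) λ c → ⋁ᶠ (height M) λ r → ifNonzeroᶠ (entry M c r) λ nz → φ ((c , r) , nz)

  module _ {s} (cv : Fin (width M) → Fin s) (rv : Fin (height M) → Fin s) where

    inCellᶠ : ∀ {e} → Cell M → Fin e → MSO (Cell M) e s
    inCellᶠ C x = and (mem x (cv (col {M} C))) (mem x (rv (row {M} C)))

    partitionᶠ : ∀ {e} → Fin e → MSO (Cell M) e s
    partitionᶠ x = and (⋁cellsᶠ λ C → inCellᶠ C x) (and (inOneLaneᶠ cv x) (inOneLaneᶠ rv x))

    separatedᶠ : ∀ {e} → MSO (Cell M) e s
    separatedᶠ = and (lanesSeparatedᶠ cv lt₁) (lanesSeparatedᶠ rv lt₂)

    precᶠ : ∀ {e} → Fin e → Fin e → MSO (Cell M) e s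
    precᶠ z m = or (lanePrecᶠ cv (colSign M) lt₁ z m) (lanePrecᶠ rv (rowSign M) lt₂ z m)

    agreesᶠ : ∀ {e} → Fin e → MSO (Cell M) e s
    agreesᶠ x = ⋁cellsᶠ λ C → and (unary C x) (inCellᶠ C x)

    inLowerCellᶠ : ∀ {e} → Cell M → Fin e → Cell M → MSO (Cell M) e s
    inLowerCellᶠ C x C' = ⟨ C' ≺lex? C ⟩∧ᶠ inCellᶠ C' x

    belowᶠ : ∀ {e} → Fin e → MSO (Cell M) e s
    belowᶠ x = ⋁cellsᶠ λ C → and (unary C x) (⋁cellsᶠ (inLowerCellᶠ C x))

    lexLessᶠ : ∀ {e} → MSO (Cell M) e s
    lexLessᶠ = exE (and (not (agreesᶠ F.zero))
                   (and (allE (lt₁ F.zero (F.suc F.zero) ⇒ᶠ agreesᶠ F.zero)) (belowᶠ F.zero)))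

  acyclicᶠ : ∀ {e s} → (Fin (width M) → Fin s) → (Fin (height M) → Fin s) → MSO (Cell M) e s
  acyclicᶠ cv rv = allS (exE (mem F.zero F.zero) ⇒ᶠ
    exE (and (mem F.zero F.zero) (allE (mem F.zero F.zero ⇒ᶠ
      not (precᶠ (F.suc ∘ cv) (F.suc ∘ rv) F.zero (F.suc F.zero))))))

  goodᶠ : ∀ {e s} → (Fin (width M) → Fin s) → (Fin (height M) → Fin s) → MSO (Cell M) e s
  goodᶠ cv rv = and (allE (partitionᶠ cv rv F.zero)) (and (separatedᶠ cv rv) (acyclicᶠ cv rv))

  cv₀ : Fin (width M) → Fin (width M ℕ.+ height M)
  cv₀ c = c ↑ˡ height M

  rv₀ : Fin (height M) → Fin (width M ℕ.+ height M)
  rv₀ r = width M ↑ʳ r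

  Min : Sentence (Cell M)
  Min = ∀ˢ (width M ℕ.+ height M) (not (and (goodᶠ cv₀ rv₀) (lexLessᶠ cv₀ rv₀)))

  Encodes : ∀ {k s} → (Fin s → Subset k) → (Fin (width M) → Fin s) → (Fin (height M) → Fin s) →
            (Fin k → Cell M) → Set
  Encodes σ cv rv h = LaneEncodes σ cv (col {M} ∘ h) × LaneEncodes σ rv (row {M} ∘ h)

  module _ {k} (π : Perm k) (g : Fin k → Cell M) where

    S : Gridded M k
    S = π ,, g

    open Semantics S

    ifNonzeroᶠ-sat : ∀ {e s} {ρ : Fin e → Fin k} {σ : Fin s → Subset k} x φ →
      Sat S ρ σ (ifNonzeroᶠ x φ) ⇔ Σ (T (isNonzero x)) λ nz → Sat S ρ σ (φ nz)
    ifNonzeroᶠ-sat {ρ = ρ} {σ} zer φ = mk⇔ (λ ⊥ → ⊥-elim (⊥ᶠ-sat {ρ = ρ} {σ} ⊥)) (λ ())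
    ifNonzeroᶠ-sat pos φ = mk⇔ (_ ,_) proj₂
    ifNonzeroᶠ-sat neg φ = mk⇔ (_ ,_) proj₂

    ⋁cellsᶠ-sat : ∀ {e s} {ρ : Fin e → Fin k} {σ : Fin s → Subset k} φ →
      Sat S ρ σ (⋁cellsᶠ φ) ⇔ Σ (Cell M) λ C → Sat S ρ σ (φ C)
    ⋁cellsᶠ-sat φ = mk⇔
      (λ sat → let (c , sat′) = to (⋁ᶠ-sat (width M) _) sat
                   (r , sat″) = to (⋁ᶠ-sat (height M) _) sat′
                   (nz , sat‴) = to (ifNonzeroᶠ-sat (entry M c r) (λ nz → φ ((c , r) , nz))) sat″
               in ((c , r) , nz) , sat‴)
      (λ { (((c , r) , nz) , sat) → from (⋁ᶠ-sat (width M) _) (c , from (⋁ᶠ-sat (height M) _)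
             (r , from (ifNonzeroᶠ-sat (entry M c r) (λ nz → φ ((c , r) , nz))) (nz , sat))) })

    module _ {s} {σ : Fin s → Subset k} {cv : Fin (width M) → Fin s} {rv : Fin (height M) → Fin s} where

      partitionᶠ-sat : ∀ {e} {ρ : Fin e → Fin k} →
        Sat S ρ σ (allE (partitionᶠ cv rv F.zero)) ⇔ Σ (Fin k → Cell M) (Encodes σ cv rv)
      partitionᶠ-sat = mk⇔
        (λ sat → let cellOf a = to (⋁cellsᶠ-sat (λ C → inCellᶠ cv rv C F.zero)) (proj₁ (sat a))
                     h a = proj₁ (cellOf a)
                 in h , inOneLane⇒laneEncodes σ cv (col {M} ∘ h) (λ a → proj₁ (proj₂ (cellOf a)))
                          (λ a → to (inOneLaneᶠ-sat σ cv F.zero) (proj₁ (proj₂ (sat a))))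
                      , inOneLane⇒laneEncodes σ rv (row {M} ∘ h) (λ a → proj₂ (proj₂ (cellOf a)))
                          (λ a → to (inOneLaneᶠ-sat σ rv F.zero) (proj₂ (proj₂ (sat a)))))
        (λ (h , colEnc , rowEnc) a →
          let (inCol , oneCol) = laneEncodes⇒inOneLane σ cv colEnc
              (inRow , oneRow) = laneEncodes⇒inOneLane σ rv rowEnc
          in from (⋁cellsᶠ-sat (λ C → inCellᶠ cv rv C F.zero)) (h a , inCol a , inRow a) ,
             from (inOneLaneᶠ-sat σ cv F.zero) (oneCol a) , from (inOneLaneᶠ-sat σ rv F.zero) (oneRow a))

    precᶠ-sat : ∀ {s} {σ : Fin s → Subset k} {cv rv h} → Encodes σ cv rv h →
      ∀ {e} {ρ : Fin e → Fin k} z m → Sat S ρ σ (precᶠ cv rv z m) ⇔ Gridding.ParamPrec M π h (ρ z) (ρ m)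
    precᶠ-sat {σ = σ} {cv} {rv} (colEnc , rowEnc) z m = mk⇔
      (Sum.map (to (colPrec z m)) (to (rowPrec z m))) (Sum.map (from (colPrec z m)) (from (rowPrec z m)))
      where
      colPrec = lanePrecᶠ-sat σ cv colEnc lt₁ {_<₁_ π} (λ _ _ → mk⇔ id id) (colSign M)
      rowPrec = lanePrecᶠ-sat σ rv rowEnc lt₂ {_<₂_ π} (λ _ _ → mk⇔ id id) (rowSign M)

    module Encoded {s} {σ : Fin s → Subset k} {cv : Fin (width M) → Fin s} {rv : Fin (height M) → Fin s}
                   {h : Fin k → Cell M} (enc : Encodes σ cv rv h) where

      open Gridding M π h

      inCellᶠ-sat : ∀ {e} (ρ : Fin e → Fin k) C x → Sat S ρ σ (inCellᶠ cv rv C x) ⇔ h (ρ x) ≡ C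
      inCellᶠ-sat ρ C x = mk⇔
        (λ (inCol , inRow) → cell-≡ {M} (to (proj₁ enc _ _) inCol) (to (proj₂ enc _ _) inRow))
        (λ { refl → from (proj₁ enc _ _) refl , from (proj₂ enc _ _) refl })

      agreesᶠ-sat : ∀ {e} (ρ : Fin e → Fin k) x → Sat S ρ σ (agreesᶠ cv rv x) ⇔ h (ρ x) ≡ g (ρ x)
      agreesᶠ-sat ρ x = mk⇔
        (λ sat → let (C , g≡C , inC) = to (⋁cellsᶠ-sat (λ C → and (unary C x) (inCellᶠ cv rv C x))) sat
                 in trans (to (inCellᶠ-sat ρ C x) inC) (sym g≡C))
        (λ h≡g → from (⋁cellsᶠ-sat (λ C → and (unary C x) (inCellᶠ cv rv C x)))
                   (g (ρ x) , refl , from (inCellᶠ-sat ρ _ x) h≡g))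

      belowᶠ-sat : ∀ {e} (ρ : Fin e → Fin k) x → Sat S ρ σ (belowᶠ cv rv x) ⇔ _≺lex_ {M} (h (ρ x)) (g (ρ x))
      belowᶠ-sat ρ x = mk⇔
        (λ sat → let (C , g≡C , sat′) = to (⋁cellsᶠ-sat below) sat
                     (C′ , sat″) = to (⋁cellsᶠ-sat (inLowerCellᶠ cv rv C x)) sat′
                     (C′≺C , inC′) = to (⟨⟩∧ᶠ-sat (C′ ≺lex? C) (inCellᶠ cv rv C′ x)) sat″
                 in subst₂ (_≺lex_ {M}) (sym (to (inCellᶠ-sat ρ C′ x) inC′)) (sym g≡C) C′≺C)
        (λ h≺g → from (⋁cellsᶠ-sat below) (g (ρ x) , refl ,
           from (⋁cellsᶠ-sat (inLowerCellᶠ cv rv (g (ρ x)) x)) (h (ρ x) ,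
             from (⟨⟩∧ᶠ-sat (h (ρ x) ≺lex? g (ρ x)) (inCellᶠ cv rv (h (ρ x)) x))
               (h≺g , from (inCellᶠ-sat ρ _ x) refl))))
        where
        below = λ C → and (unary C x) (⋁cellsᶠ (inLowerCellᶠ cv rv C x))

      lexLessᶠ-sat : ∀ {e} {ρ : Fin e → Fin k} → Sat S ρ σ (lexLessᶠ cv rv) ⇔ LexLess M π h g
      lexLessᶠ-sat {ρ = ρ} = mk⇔
        (λ (p , disagree , earlier , below) →
          p , (λ agree → disagree (from (agreesᶠ-sat (extend ρ p) F.zero) agree)) ,
          (λ q q<p → to (agreesᶠ-sat (extend (extend ρ p) q) F.zero) (to (¬⊎⇔→ (q <₁? p)) (earlier q) q<p)) ,
          to (belowᶠ-sat (extend ρ p) F.zero) below)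
        (λ (p , disagree , earlier , below) →
          p , (λ agree → disagree (to (agreesᶠ-sat (extend ρ p) F.zero) agree)) ,
          (λ q → from (¬⊎⇔→ (q <₁? p)) λ q<p → from (agreesᶠ-sat (extend (extend ρ p) q) F.zero) (earlier q q<p)) ,
          from (belowᶠ-sat (extend ρ p) F.zero) below)
        where
        _<₁?_ = IsStrictTotalOrder._<?_ (isLin₁ π)

      separatedᶠ-sat : ∀ {e} {ρ : Fin e → Fin k} → Sat S ρ σ (separatedᶠ cv rv) ⇔ Separated
      separatedᶠ-sat = mk⇔ (λ (xs , ys) → to colSep xs , to rowSep ys)
                           (λ (xs , ys) → from colSep xs , from rowSep ys)
        where
        colSep = lanesSeparatedᶠ-sat σ cv (proj₁ enc) lt₁ {_<₁_ π} (λ _ _ → mk⇔ id id)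
        rowSep = lanesSeparatedᶠ-sat σ rv (proj₂ enc) lt₂ {_<₂_ π} (λ _ _ → mk⇔ id id)

      acyclicᶠ-sat : ∀ {e} {ρ : Fin e → Fin k} → Sat S ρ σ (acyclicᶠ cv rv) ⇔ Acyclic ParamPrec
      acyclicᶠ-sat {ρ = ρ} = mk⇔ sat⇒acyclic acyclic⇒sat
        where
        precᶠ′ : ∀ Z m z → Sat S (extend (extend ρ m) z) (extend σ Z)
                             (precᶠ (F.suc ∘ cv) (F.suc ∘ rv) F.zero (F.suc F.zero)) ⇔ ParamPrec z m
        -- enc also serves for the valuation extended by Z, as extend σ Z (F.suc i) = σ i.
        precᶠ′ Z m z = precᶠ-sat {σ = extend σ Z} {cv = F.suc ∘ cv} {rv = F.suc ∘ rv} {h = h} enc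
                         {ρ = extend (extend ρ m) z} F.zero (F.suc F.zero)

        sat⇒acyclic : Sat S ρ σ (acyclicᶠ cv rv) → Acyclic ParamPrec
        sat⇒acyclic sat Z nonempty with to (¬⊎⇔→ (nonempty? Z)) (sat Z) nonempty
        ... | m , m∈Z , minimal =
          m , m∈Z , λ z z∈Z prec → to (¬⊎⇔→ (z ∈? Z)) (minimal z) z∈Z (from (precᶠ′ Z m z) prec)

        acyclic⇒sat : Acyclic ParamPrec → Sat S ρ σ (acyclicᶠ cv rv)
        acyclic⇒sat acyclic Z = from (¬⊎⇔→ (nonempty? Z)) λ nonempty →
          let (m , m∈Z , minimal) = acyclic Z nonempty
          in m , m∈Z , λ z → from (¬⊎⇔→ (z ∈? Z)) λ z∈Z prec → minimal z z∈Z (to (precᶠ′ Z m z) prec)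

    goodᶠ-sat : ∀ {s} {σ : Fin s → Subset k} {cv rv} {e} {ρ : Fin e → Fin k} →
      Sat S ρ σ (goodᶠ cv rv) ⇔ Σ (Fin k → Cell M) λ h → Encodes σ cv rv h × Drawable M π h
    goodᶠ-sat {σ = σ} {cv} {rv} {ρ = ρ} = mk⇔
      (λ (partition , separated , acyclic) →
        let (h , enc) = to (partitionᶠ-sat {ρ = ρ}) partition
            open Encoded {σ = σ} {cv} {rv} {h} enc
        in h , enc , Gridding.separated∧acyclic⇒drawable M π h
                       (to (separatedᶠ-sat {ρ = ρ}) separated) (to (acyclicᶠ-sat {ρ = ρ}) acyclic))
      (λ (h , enc , drawable) →
        let open Encoded {σ = σ} {cv} {rv} {h} enc
        in from (partitionᶠ-sat {ρ = ρ}) (h , enc) ,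
           from (separatedᶠ-sat {ρ = ρ}) (Gridding.drawable⇒separated M π h drawable) ,
           from (acyclicᶠ-sat {ρ = ρ}) (Gridding.drawable⇒acyclic M π h drawable))

    encodingSets : (Fin k → Cell M) → Fin (width M ℕ.+ height M) → Subset k
    encodingSets h = [ laneSet (col {M} ∘ h) , laneSet (row {M} ∘ h) ] ∘ F.splitAt (width M)

    expand-encodingSets : ∀ σ₀ h → Encodes (expand σ₀ (encodingSets h)) cv₀ rv₀ h
    expand-encodingSets σ₀ h =
      (λ a c → subst (λ X → a ∈ X ⇔ col {M} (h a) ≡ c)
                 (sym (trans (expand-≡ σ₀ _ (cv₀ c)) (cong [ _ , _ ] (FP.splitAt-↑ˡ (width M) c (height M)))))
                 (laneSet-encodes (col {M} ∘ h) a c)) ,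
      (λ a r → subst (λ X → a ∈ X ⇔ row {M} (h a) ≡ r)
                 (sym (trans (expand-≡ σ₀ _ (rv₀ r)) (cong [ _ , _ ] (FP.splitAt-↑ʳ (width M) (height M) r))))
                 (laneSet-encodes (row {M} ∘ h) a r))

    ⊨Min⇔lexMinimal : S ⊨ Min ⇔ LexMinimal M π g
    ⊨Min⇔lexMinimal = mk⇔ ⊨Min⇒lexMinimal lexMinimal⇒⊨Min
      where
      body = not (and (goodᶠ cv₀ rv₀) (lexLessᶠ cv₀ rv₀))

      ⊨Min⇒lexMinimal : S ⊨ Min → LexMinimal M π g
      ⊨Min⇒lexMinimal sat h drawable h<g = to (∀ˢ-sat _ body) sat (encodingSets h)
        (from goodᶠ-sat (h , enc , drawable) , from (Encoded.lexLessᶠ-sat enc) h<g)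
        where
        enc = expand-encodingSets _ h

      lexMinimal⇒⊨Min : LexMinimal M π g → S ⊨ Min
      lexMinimal⇒⊨Min minimal = from (∀ˢ-sat _ body) λ τ (good , h<g) →
        let (h , enc , drawable) = to goodᶠ-sat good
        in minimal h drawable (to (Encoded.lexLessᶠ-sat enc) h<g)

mainTheorem9 : Σ ((M : PMM) → Sentence (Cell M)) λ Min →
    ∀ (M : PMM) {k : ℕ} (π : Perm k) (g : Fin k → Cell M) →
      Drawable M π g →
      (_⊨_ {M} (π ,, g) (Min M)) ⇔ LexMinimal M π g
mainTheorem9 = MinSentence.Min , λ M π g _ → MinSentence.⊨Min⇔lexMinimal M π g
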